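{- Let $K$ be a field of characteristic $0$, $f(z)\in(1/z)K[[1/z]]$ and $D\in K[z,\partial_z]$. Then $D\cdot f\in K[z]$ if and only if $D^*(K[t])\subseteq\ker\varphi_f$.
   Context: For $f(z)=\sum_{k\ge0}f_k/z^{k+1}$, $\varphi_f:K[t]\to K$ is the $K$-linear map $t^k\mapsto f_k$. $D$ acts on $K((1/z))$ by differentiation in $z$. For $D=\sum_jP_j(z)\partial_z^j$, the adjoint $D^*=\sum_j(-1)^j\partial_t^jP_j(t)$ acts on $K[t]$ by $g\mapsto\sum_j(-1)^j\frac{d^j}{dt^j}(P_j(t)g(t))$. -}

module Defs where

open import Level using (Level; _⊔_)
open import Algebra.Bundles using (CommutativeRing)
open import Data.Nat using (ℕ; zero; suc)
open import Data.Integer as ℤ using (ℤ; +_; -[1+_])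
open import Data.List using (List; []; _∷_)
open import Data.Product using (Σ; _×_)
open import Relation.Nullary using (¬_)

module Ops {c ℓ : Level} (K : CommutativeRing c ℓ) where
  open CommutativeRing K

  IsField : Set (c ⊔ ℓ)
  IsField = (¬ (1# ≈ 0#)) × (∀ x → ¬ (x ≈ 0#) → Σ Carrier λ y → (x * y) ≈ 1#)

  _·ₙ_ : ℕ → Carrier → Carrier
  zero ·ₙ x = 0#
  suc n ·ₙ x = x + (n ·ₙ x)

  CharZero : Set ℓ
  CharZero = ∀ n → ¬ ((suc n ·ₙ 1#) ≈ 0#)

  _·ᵢ_ : ℤ → Carrier → Carrier
  (+ n) ·ᵢ x = n ·ₙ x
  -[1+ n ] ·ᵢ x = - (suc n ·ₙ x)

  -- Polynomials K[t] (also K[z]): coefficient lists, constant term first.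
  Poly : Set c
  Poly = List Carrier

  addP : Poly → Poly → Poly
  addP [] q = q
  addP (a ∷ p) [] = a ∷ p
  addP (a ∷ p) (b ∷ q) = (a + b) ∷ addP p q

  scaleP : Carrier → Poly → Poly
  scaleP a [] = []
  scaleP a (b ∷ p) = (a * b) ∷ scaleP a p

  negP : Poly → Poly
  negP = scaleP (- 1#)

  mulP : Poly → Poly → Poly
  mulP [] q = []
  mulP (a ∷ p) q = addP (scaleP a q) (0# ∷ mulP p q)

  derivP-from : ℕ → Poly → Poly
  derivP-from k [] = []
  derivP-from k (a ∷ p) = (k ·ₙ a) ∷ derivP-from (suc k) p

  derivP : Poly → Poly
  derivP [] = []
  derivP (a ∷ p) = derivP-from 1 p

  -- The linear functional φ_f : K[t] → K, t^k ↦ f_k,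
  -- for f(z) = Σ_{k≥0} f_k / z^(k+1), given by its coefficient sequence f.
  φ-from : (ℕ → Carrier) → ℕ → Poly → Carrier
  φ-from f k [] = 0#
  φ-from f k (a ∷ p) = (a * f k) + φ-from f (suc k) p

  φ : (ℕ → Carrier) → Poly → Carrier
  φ f = φ-from f 0

  -- Elements of K((1/z)) represented by their coefficient function:
  -- s e is the coefficient of z^e.  (All operations used below are
  -- finite on coefficients, so no support condition is needed.)
  Ser : Set c
  Ser = ℤ → Carrier

  embed : (ℕ → Carrier) → Ser
  embed f (+ n) = 0#
  embed f -[1+ k ] = f k

  addS : Ser → Ser → Ser
  addS s u e = s e + u e

  zeroS : Ser
  zeroS e = 0#

  derivS : Ser → Ser
  derivS s e = (e ℤ.+ ℤ.1ℤ) ·ᵢ s (e ℤ.+ ℤ.1ℤ)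

  mulPS : Poly → Ser → Ser
  mulPS [] s e = 0#
  mulPS (p ∷ ps) s e = (p * s e) + mulPS ps s (e ℤ.- ℤ.1ℤ)

  -- Differential operators D = Σ_j P_j(z) ∂_z^j ∈ K[z,∂_z],
  -- represented by the list [P_0, P_1, ..., P_m].
  DiffOp : Set c
  DiffOp = List Poly

  applyD : DiffOp → Ser → Ser
  applyD [] s = zeroS
  applyD (P ∷ Ps) s = addS (mulPS P s) (applyD Ps (derivS s))

  -- D* g = Σ_j (-1)^j d^j/dt^j (P_j(t) g(t))
  --      = P_0 g - d/dt ( Σ_{j≥1} (-1)^(j-1) d^(j-1)/dt^(j-1) (P_j g) )
  adjoint : DiffOp → Poly → Poly
  adjoint [] g = []
  adjoint (P ∷ Ps) g = addP (mulP P g) (negP (derivP (adjoint Ps g)))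

  InPoly : Ser → Set ℓ
  InPoly s = ∀ n → s -[1+ n ] ≈ 0#

  ImageInKer : (ℕ → Carrier) → DiffOp → Set (c ⊔ ℓ)
  ImageInKer f D = ∀ (g : Poly) → φ f (adjoint D g) ≈ 0#

-- The residue pairing ⟨ g , s ⟩ = res (g(z) s(z)) on K[t] × K((1/z)) satisfies
-- φ_f(g) = ⟨ g , f ⟩.  Multiplication by P(z) is self-adjoint for it, and integration
-- by parts, res (g′ s) = - res (g s′), makes D* the adjoint of D, so
-- φ_f(D* g) = ⟨ g , D · f ⟩.  Pairing with the monomials tⁿ reads off the coefficients
-- of the negative powers of z, so all of these vanish exactly when D · f ∈ K[z].
-- Nothing here divides, so the equivalence holds over every commutative ring.
module Submission where

open import Defs
open import Level using (Level)
open import Algebra.Bundles using (CommutativeRing)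
open import Data.Nat using (ℕ; zero; suc)
open import Function.Bundles using (_⇔_; mk⇔; Equivalence)

import Data.Nat as ℕ
import Data.Nat.Properties as ℕ
open import Data.Integer as ℤ using (-[1+_])
open import Data.List using ([]; _∷_)
open import Relation.Binary.PropositionalEquality as ≡ using (_≡_)
import Algebra.Properties.Ring as RingProperties
import Algebra.Properties.CommutativeSemigroup as CommutativeSemigroupProperties
import Algebra.Properties.Semiring.Mult as SemiringMult

module ResiduePairing {c ℓ : Level} (K : CommutativeRing c ℓ) where
  open CommutativeRing K
  open Ops K
  open RingProperties ring using (-‿involutive; -‿distribʳ-*; -‿+-comm; -0#≈0#; -1*x≈-x)
  open CommutativeSemigroupProperties +-commutativeSemigroup using (interchange)
  open CommutativeSemigroupProperties *-commutativeSemigroup using (x∙yz≈y∙xz)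
  open SemiringMult semiring using (_×_; ×-assoc-*; ×-comm-*)
  open import Relation.Binary.Reasoning.Setoid setoid

  -- pairing-from k g s = res (zᵏ g(z) s(z)).
  pairing-from : ℕ → Poly → Ser → Carrier
  pairing-from k [] s = 0#
  pairing-from k (a ∷ p) s = a * s -[1+ k ] + pairing-from (suc k) p s

  ⟨_,_⟩ : Poly → Ser → Carrier
  ⟨ g , s ⟩ = pairing-from 0 g s

  φ-from≡pairing-from : ∀ f k p → φ-from f k p ≡ pairing-from k p (embed f)
  φ-from≡pairing-from f k [] = ≡.refl
  φ-from≡pairing-from f k (a ∷ p) = ≡.cong (a * f k +_) (φ-from≡pairing-from f (suc k) p)

  φ≡pairing-embed : ∀ f g → φ f g ≡ ⟨ g , embed f ⟩
  φ≡pairing-embed f = φ-from≡pairing-from f 0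

  pairing-addP : ∀ k p q s →
    pairing-from k (addP p q) s ≈ pairing-from k p s + pairing-from k q s
  pairing-addP k [] q s = sym (+-identityˡ _)
  pairing-addP k (a ∷ p) [] s = sym (+-identityʳ _)
  pairing-addP k (a ∷ p) (b ∷ q) s = begin
    (a + b) * s e + pairing-from (suc k) (addP p q) s
      ≈⟨ +-cong (distribʳ (s e) a b) (pairing-addP (suc k) p q s) ⟩
    (a * s e + b * s e) + (pairing-from (suc k) p s + pairing-from (suc k) q s)
      ≈⟨ interchange _ _ _ _ ⟩
    (a * s e + pairing-from (suc k) p s) + (b * s e + pairing-from (suc k) q s) ∎
    where e = -[1+ k ]

  pairing-scaleP : ∀ k a p s → pairing-from k (scaleP a p) s ≈ a * pairing-from k p s
  pairing-scaleP k a [] s = sym (zeroʳ a)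
  pairing-scaleP k a (b ∷ p) s = begin
    a * b * s e + pairing-from (suc k) (scaleP a p) s
      ≈⟨ +-cong (*-assoc a b (s e)) (pairing-scaleP (suc k) a p s) ⟩
    a * (b * s e) + a * pairing-from (suc k) p s
      ≈⟨ distribˡ a _ _ ⟨
    a * (b * s e + pairing-from (suc k) p s) ∎
    where e = -[1+ k ]

  pairing-negP : ∀ k p s → pairing-from k (negP p) s ≈ - pairing-from k p s
  pairing-negP k p s = trans (pairing-scaleP k (- 1#) p s) (-1*x≈-x _)

  pairing-addS : ∀ k p s u →
    pairing-from k p (addS s u) ≈ pairing-from k p s + pairing-from k p u
  pairing-addS k [] s u = sym (+-identityˡ 0#)
  pairing-addS k (a ∷ p) s u = begin
    a * (s e + u e) + pairing-from (suc k) p (addS s u)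
      ≈⟨ +-cong (distribˡ a (s e) (u e)) (pairing-addS (suc k) p s u) ⟩
    (a * s e + a * u e) + (pairing-from (suc k) p s + pairing-from (suc k) p u)
      ≈⟨ interchange _ _ _ _ ⟩
    (a * s e + pairing-from (suc k) p s) + (a * u e + pairing-from (suc k) p u) ∎
    where e = -[1+ k ]

  pairing-scaleS : ∀ k p b s →
    pairing-from k p (λ e → b * s e) ≈ b * pairing-from k p s
  pairing-scaleS k [] b s = sym (zeroʳ b)
  pairing-scaleS k (a ∷ p) b s = begin
    a * (b * s e) + pairing-from (suc k) p (λ e → b * s e)
      ≈⟨ +-cong (x∙yz≈y∙xz a b (s e)) (pairing-scaleS (suc k) p b s) ⟩
    b * (a * s e) + b * pairing-from (suc k) p s
      ≈⟨ distribˡ b _ _ ⟨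
    b * (a * s e + pairing-from (suc k) p s) ∎
    where e = -[1+ k ]

  pairing-InPoly : ∀ {u} → InPoly u → ∀ k g → pairing-from k g u ≈ 0#
  pairing-InPoly u∈K[z] k [] = refl
  pairing-InPoly {u} u∈K[z] k (a ∷ p) = begin
    a * u -[1+ k ] + pairing-from (suc k) p u
      ≈⟨ +-cong (trans (*-congˡ (u∈K[z] k)) (zeroʳ a)) (pairing-InPoly u∈K[z] (suc k) p) ⟩
    0# + 0#
      ≈⟨ +-identityˡ 0# ⟩
    0# ∎

  pairing-mulZ : ∀ k p u →
    pairing-from k p (λ e → u (e ℤ.- ℤ.1ℤ)) ≈ pairing-from (suc k) p u
  pairing-mulZ k [] u = refl
  pairing-mulZ k (a ∷ p) u =
    +-cong (*-congˡ (reflexive (≡.cong (λ m → u -[1+ suc m ]) (ℕ.+-identityʳ k))))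
           (pairing-mulZ (suc k) p u)

  pairing-mulP : ∀ P g k s → pairing-from k (mulP P g) s ≈ pairing-from k g (mulPS P s)
  pairing-mulP [] g k s = sym (pairing-InPoly (λ _ → refl) k g)
  pairing-mulP (a ∷ p) g k s = begin
    pairing-from k (addP (scaleP a g) (0# ∷ mulP p g)) s
      ≈⟨ pairing-addP k (scaleP a g) (0# ∷ mulP p g) s ⟩
    pairing-from k (scaleP a g) s + (0# * s -[1+ k ] + pairing-from (suc k) (mulP p g) s)
      ≈⟨ +-cong (pairing-scaleP k a g s) (trans (+-congʳ (zeroˡ _)) (+-identityˡ _)) ⟩
    a * pairing-from k g s + pairing-from (suc k) (mulP p g) s
      ≈⟨ +-congˡ (pairing-mulP p g (suc k) s) ⟩
    a * pairing-from k g s + pairing-from (suc k) g (mulPS p s)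
      ≈⟨ +-cong (pairing-scaleS k g a s) (pairing-mulZ k g (mulPS p s)) ⟨
    pairing-from k g (λ e → a * s e) + pairing-from k g (λ e → mulPS p s (e ℤ.- ℤ.1ℤ))
      ≈⟨ pairing-addS k g _ _ ⟨
    pairing-from k g (mulPS (a ∷ p) s) ∎

  ·ₙ≡× : ∀ n x → n ·ₙ x ≡ n × x
  ·ₙ≡× zero x = ≡.refl
  ·ₙ≡× (suc n) x = ≡.cong (x +_) (·ₙ≡× n x)

  -- derivS s -[1+ suc k ] unfolds to -[1+ k ] ·ᵢ s -[1+ k ] = - (suc k ·ₙ s -[1+ k ]).
  pairing-derivP-from : ∀ k p s →
    pairing-from k (derivP-from (suc k) p) s ≈ - pairing-from (suc k) p (derivS s)
  pairing-derivP-from k [] s = sym -0#≈0#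
  pairing-derivP-from k (b ∷ p) s = begin
    (suc k ·ₙ b) * s e + pairing-from (suc k) (derivP-from (suc (suc k)) p) s
      ≈⟨ +-cong coefficient (pairing-derivP-from (suc k) p s) ⟩
    - (b * derivS s -[1+ suc k ]) + - pairing-from (suc (suc k)) p (derivS s)
      ≈⟨ -‿+-comm _ _ ⟩
    - (b * derivS s -[1+ suc k ] + pairing-from (suc (suc k)) p (derivS s)) ∎
    where
    e = -[1+ k ]
    coefficient : (suc k ·ₙ b) * s e ≈ - (b * derivS s -[1+ suc k ])
    coefficient = begin
      (suc k ·ₙ b) * s e     ≡⟨ ≡.cong (_* s e) (·ₙ≡× (suc k) b) ⟩
      (suc k × b) * s e      ≈⟨ ×-assoc-* (suc k) b (s e) ⟩
      suc k × (b * s e)      ≈⟨ ×-comm-* (suc k) b (s e) ⟨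
      b * (suc k × s e)      ≡⟨ ≡.cong (b *_) (·ₙ≡× (suc k) (s e)) ⟨
      b * (suc k ·ₙ s e)     ≈⟨ -‿involutive _ ⟨
      - - (b * (suc k ·ₙ s e)) ≈⟨ -‿cong (-‿distribʳ-* b _) ⟩
      - (b * - (suc k ·ₙ s e)) ∎

  pairing-derivP : ∀ g s → ⟨ derivP g , s ⟩ ≈ - ⟨ g , derivS s ⟩
  pairing-derivP [] s = sym -0#≈0#
  pairing-derivP (a ∷ p) s = trans (pairing-derivP-from 0 p s)
    (-‿cong (sym (trans (+-congʳ (zeroʳ a)) (+-identityˡ _))))

  pairing-adjoint : ∀ D g s → ⟨ adjoint D g , s ⟩ ≈ ⟨ g , applyD D s ⟩
  pairing-adjoint [] g s = sym (pairing-InPoly (λ _ → refl) 0 g)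
  pairing-adjoint (Q ∷ Qs) g s = begin
    ⟨ addP (mulP Q g) (negP (derivP (adjoint Qs g))) , s ⟩
      ≈⟨ pairing-addP 0 (mulP Q g) (negP (derivP (adjoint Qs g))) s ⟩
    ⟨ mulP Q g , s ⟩ + ⟨ negP (derivP (adjoint Qs g)) , s ⟩
      ≈⟨ +-cong (pairing-mulP Q g 0 s) (pairing-negP 0 (derivP (adjoint Qs g)) s) ⟩
    ⟨ g , mulPS Q s ⟩ + - ⟨ derivP (adjoint Qs g) , s ⟩
      ≈⟨ +-congˡ (-‿cong (pairing-derivP (adjoint Qs g) s)) ⟩
    ⟨ g , mulPS Q s ⟩ + - - ⟨ adjoint Qs g , derivS s ⟩
      ≈⟨ +-congˡ (-‿involutive _) ⟩
    ⟨ g , mulPS Q s ⟩ + ⟨ adjoint Qs g , derivS s ⟩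
      ≈⟨ +-congˡ (pairing-adjoint Qs g (derivS s)) ⟩
    ⟨ g , mulPS Q s ⟩ + ⟨ g , applyD Qs (derivS s) ⟩
      ≈⟨ pairing-addS 0 g _ _ ⟨
    ⟨ g , applyD (Q ∷ Qs) s ⟩ ∎

  monomial : ℕ → Poly
  monomial zero = 1# ∷ []
  monomial (suc n) = 0# ∷ monomial n

  pairing-monomial : ∀ u n k → pairing-from k (monomial n) u ≈ u -[1+ n ℕ.+ k ]
  pairing-monomial u zero k = trans (+-identityʳ _) (*-identityˡ _)
  pairing-monomial u (suc n) k = begin
    0# * u -[1+ k ] + pairing-from (suc k) (monomial n) u
      ≈⟨ trans (+-congʳ (zeroˡ _)) (+-identityˡ _) ⟩
    pairing-from (suc k) (monomial n) u
      ≈⟨ pairing-monomial u n (suc k) ⟩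
    u -[1+ n ℕ.+ suc k ]
      ≡⟨ ≡.cong (λ m → u -[1+ m ]) (ℕ.+-suc n k) ⟩
    u -[1+ suc n ℕ.+ k ] ∎

  InPoly⇔pairing≈0 : ∀ u → InPoly u ⇔ (∀ g → ⟨ g , u ⟩ ≈ 0#)
  InPoly⇔pairing≈0 u = mk⇔ (λ u∈K[z] → pairing-InPoly u∈K[z] 0) λ ⟨-,u⟩≈0 n → begin
    u -[1+ n ]      ≡⟨ ≡.cong (λ m → u -[1+ m ]) (ℕ.+-identityʳ n) ⟨
    u -[1+ n ℕ.+ 0 ]  ≈⟨ pairing-monomial u n 0 ⟨
    ⟨ monomial n , u ⟩ ≈⟨ ⟨-,u⟩≈0 (monomial n) ⟩
    0# ∎

  InPoly-applyD⇔ImageInKer : ∀ f D → InPoly (applyD D (embed f)) ⇔ ImageInKer f D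
  InPoly-applyD⇔ImageInKer f D = mk⇔
    (λ Df∈K[z] g → trans (φ-adjoint g) (to Df∈K[z] g))
    (λ D*⊆kerφ → from λ g → trans (sym (φ-adjoint g)) (D*⊆kerφ g))
    where
    open Equivalence (InPoly⇔pairing≈0 (applyD D (embed f)))
    φ-adjoint : ∀ g → φ f (adjoint D g) ≈ ⟨ g , applyD D (embed f) ⟩
    φ-adjoint g = trans (reflexive (φ≡pairing-embed f (adjoint D g))) (pairing-adjoint D g (embed f))

corollary2p6 : {c ℓ : Level} (K : CommutativeRing c ℓ)
    → Ops.IsField K → Ops.CharZero K
    → (f : ℕ → CommutativeRing.Carrier K) (D : Ops.DiffOp K)
    → Ops.InPoly K (Ops.applyD K D (Ops.embed K f)) ⇔ Ops.ImageInKer K f D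
corollary2p6 K _ _ = ResiduePairing.InPoly-applyD⇔ImageInKer K
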